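{- Let $m, n \ge 2$ be integers and let $D = C_m \Box C_n$ be the Cartesian product of directed cycles, with vertex set $\mathbb{Z}_m \times \mathbb{Z}_n$ and arcs $(i,j) \to (i+1,j)$ and $(i,j) \to (i,j+1)$. Then there exists an Italian dominating function $f$ of $D$ of minimum weight $\gamma_I(D)$ such that no three consecutive vertices (horizontally or vertically) are all assigned $0$ by $f$; that is, there are no $(i,k)$ with $f((i,k)) = f((i+1,k)) = f((i+2,k)) = 0$, and no $(i,k)$ with $f((i,k)) = f((i,k+1)) = f((i,k+2)) = 0$.
   Context: For a digraph $D$, an Italian dominating function is a function $f: V(D) \to \{0,1,2\}$ such that every vertex $v$ with $f(v)=0$ has an in-neighbour $w$ with $f(w)=2$ or two in-neighbours $x_1, x_2$ with $f(x_1)=f(x_2)=1$. Its weight is $\sum_{v \in V(D)} f(v)$, and the Italian domination number $\gamma_I(D)$ is the minimum weight of an Italian dominating function; a $\gamma_I(D)$-function is an Italian dominating function of weight $\gamma_I(D)$. -}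

module Defs where

open import Data.Nat using (ℕ; zero; suc; _+_; _≤_; _%_; NonZero)
open import Data.Nat.ListAction using (sum)
open import Data.Fin using (Fin; toℕ; fromℕ<)
open import Data.Nat.DivMod using (m%n<n)
open import Data.List using (List; map; allFin; cartesianProduct)
open import Data.Product using (_×_; _,_; ∃-syntax)
open import Data.Sum using (_⊎_)
open import Relation.Binary.PropositionalEquality using (_≡_; _≢_)

Val : Set
Val = Fin 3

val : Val → ℕ
val = toℕ

-- A finite digraph given by a vertex type V, an arc relation Arc
-- (Arc w v means an arc w → v), and a list `verts` enumerating every
-- vertex exactly once (used for the weight).
module Italian {V : Set} (Arc : V → V → Set) (verts : List V) where

  IsItalian : (V → Val) → Set
  IsItalian f = ∀ v → val (f v) ≡ 0 →
      (∃[ w ] (Arc w v × val (f w) ≡ 2))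
    ⊎ (∃[ x₁ ] ∃[ x₂ ] (x₁ ≢ x₂ × Arc x₁ v × Arc x₂ v
                        × val (f x₁) ≡ 1 × val (f x₂) ≡ 1))

  weight : (V → Val) → ℕ
  weight f = sum (map (λ v → val (f v)) verts)

  IsGammaI : (V → Val) → Set
  IsGammaI f = IsItalian f × (∀ g → IsItalian g → weight f ≤ weight g)

sucMod : ∀ {n} → .{{NonZero n}} → Fin n → Fin n
sucMod {n} i = fromℕ< (m%n<n (suc (toℕ i)) n)

data TorusArc (m n : ℕ) .{{_ : NonZero m}} .{{_ : NonZero n}} :
       Fin m × Fin n → Fin m × Fin n → Set where
  horiz : ∀ i j → TorusArc m n (i , j) (sucMod i , j)
  vert  : ∀ i j → TorusArc m n (i , j) (i , sucMod j)

torusVerts : (m n : ℕ) → List (Fin m × Fin n)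
torusVerts m n = cartesianProduct (allFin m) (allFin n)

-- Among γ_I-functions take one with the fewest zeros. If (i,k), (i+1,k) and (i+2,k) are all 0,
-- then (i+1,k) and (i+2,k) each have only one in-neighbour besides a 0-vertex, namely
-- (i+1,k-1) and (i+2,k-1), so both carry 2. Moving one unit from (i+1,k-1) to (i+1,k) keeps the
-- weight, removes a zero, and keeps the function Italian: the out-neighbours of (i+1,k-1) are
-- (i+1,k) itself and (i+2,k-1), which still has value 2. Only injectivity and commutation of
-- the two shifts (i,j) ↦ (i+1,j) and (i,j) ↦ (i,j+1) are used, so the vertical case is the same
-- argument with the shifts exchanged.
module Submission where

open import Defs
open import Data.Nat using (ℕ; _≤_; NonZero)
open import Data.Fin using (Fin; zero)
open import Data.Product using (_×_; _,_; ∃-syntax)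
open import Relation.Binary.PropositionalEquality using (_≡_)
open import Relation.Nullary using (¬_)

open import Data.Nat using (suc; pred; _+_; _∸_; _^_; _<_; _%_) renaming (_≟_ to _≟ℕ_)
open import Data.Nat.Properties
  using (+-suc; +-commutativeSemigroup; suc-injective; suc-pred; 1+n≢0; ≤-trans; ≤-reflexive; <⇒≱)
open import Algebra.Properties.CommutativeSemigroup +-commutativeSemigroup using (x∙yz≈y∙xz)
open import Data.Nat.DivMod using (%-distribˡ-+; m%n%n≡m%n; [m+n]%n≡m%n; m<n⇒m%n≡m)
open import Data.Nat.ListAction using (sum)
open import Data.Fin using (toℕ; finToFun; funToFin) renaming (_≟_ to _≟Fin_)
open import Data.Fin.Properties using (toℕ-fromℕ<; toℕ<n; toℕ-injective; finToFun-funToFin)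
open import Data.List using (List; _∷_; map; filter; allFin)
open import Data.List.Properties using (map-cong)
open import Data.List.Extrema.Nat using (argmin; argmin-all; f[argmin]≤f[xs])
open import Data.List.Membership.Propositional using (_∈_; lose)
open import Data.List.Membership.Propositional.Properties using (∈-filter⁺; ∈-allFin; ∈-cartesianProduct⁺)
open import Data.List.Relation.Unary.All as All using (All; []; _∷_)
open import Data.List.Relation.Unary.All.Properties using (all-filter)
open import Data.List.Relation.Unary.Any as Any using (here; there)
open import Data.List.Relation.Unary.Unique.Propositional using (Unique; _∷_)
open import Data.List.Relation.Unary.Unique.Propositional.Properties using (allFin⁺; cartesianProduct⁺)
open import Data.Product using (proj₁; proj₂)
open import Data.Product.Properties using (≡-dec)
open import Data.Sum using (_⊎_; inj₁; inj₂; swap)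
open import Data.Empty using (⊥-elim)
open import Function using (_∘_)
open import Relation.Binary.Definitions using (Decidable; DecidableEquality)
open import Relation.Binary.PropositionalEquality
  using (_≢_; _≗_; refl; sym; trans; cong; cong₂; module ≡-Reasoning)
open import Relation.Nullary using (Dec; yes; no)
open import Relation.Nullary.Decidable using (map′; _×-dec_; _⊎-dec_; _→-dec_; ¬?)

minimal-satisfying : ∀ {A : Set} {P : A → Set} (P? : ∀ x → Dec (P x)) (κ : A → ℕ) {a : A} →
  P a → (xs : List A) → ∃[ b ] (P b × (∀ {x} → x ∈ xs → P x → κ b ≤ κ x))
minimal-satisfying P? κ {a} Pa xs =
  argmin κ a (filter P? xs) ,
  argmin-all κ Pa (all-filter P? xs) ,
  λ x∈xs Px → All.lookup (f[argmin]≤f[xs] {f = κ} a (filter P? xs)) (∈-filter⁺ P? x∈xs Px)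

one : Val
one = Data.Fin.suc zero

module ItalianProperties {V : Set} (Arc : V → V → Set) (verts : List V) (_≟_ : DecidableEquality V)
                         (verts-unique : Unique verts) (∈-verts : ∀ v → v ∈ verts) where

  open Italian Arc verts
  open ≡-Reasoning

  Dominated : (V → Val) → V → Set
  Dominated f v = (∃[ w ] (Arc w v × val (f w) ≡ 2))
                ⊎ (∃[ x₁ ] ∃[ x₂ ] (x₁ ≢ x₂ × Arc x₁ v × Arc x₂ v × val (f x₁) ≡ 1 × val (f x₂) ≡ 1))

  sumOver : (Val → ℕ) → (V → Val) → ℕ
  sumOver φ f = sum (map (φ ∘ f) verts)

  isZero : Val → ℕ
  isZero x = 1 ∸ val x

  zeroCount : (V → Val) → ℕ
  zeroCount = sumOver isZero

  Improvable : (V → Val) → Set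
  Improvable f = ∃[ g ] (IsItalian g × weight g ≡ weight f × zeroCount g < zeroCount f)

  values-≢ : ∀ {f : V → Val} {x y a b} → val (f x) ≡ a → val (f y) ≡ b → a ≢ b → x ≢ y
  values-≢ fx≡a fy≡b a≢b refl = a≢b (trans (sym fx≡a) fy≡b)

  other-inNeighbour-two : ∀ {f v w} → IsItalian f → val (f v) ≡ 0 → val (f w) ≡ 0 →
    (∀ {x y} → Arc x v → Arc y v → x ≢ w → y ≢ w → x ≡ y) →
    ∃[ p ] (Arc p v × val (f p) ≡ 2)
  other-inNeighbour-two {v = v} fI fv≡0 fw≡0 coincide with fI v fv≡0
  ... | inj₁ two = two
  ... | inj₂ (x₁ , x₂ , x₁≢x₂ , x₁→v , x₂→v , fx₁≡1 , fx₂≡1) =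
    ⊥-elim (x₁≢x₂ (coincide x₁→v x₂→v (values-≢ fx₁≡1 fw≡0 λ ()) (values-≢ fx₂≡1 fw≡0 λ ())))

  isItalian-resp-≗ : ∀ {f g} → f ≗ g → IsItalian g → IsItalian f
  isItalian-resp-≗ f≗g gI v fv≡0 with gI v (trans (cong val (sym (f≗g v))) fv≡0)
  ... | inj₁ (w , w→v , gw≡2) = inj₁ (w , w→v , trans (cong val (f≗g w)) gw≡2)
  ... | inj₂ (x₁ , x₂ , x₁≢x₂ , x₁→v , x₂→v , gx₁≡1 , gx₂≡1) =
    inj₂ (x₁ , x₂ , x₁≢x₂ , x₁→v , x₂→v , trans (cong val (f≗g x₁)) gx₁≡1 , trans (cong val (f≗g x₂)) gx₂≡1)

  sumOver-resp-≗ : ∀ φ {f g} → f ≗ g → sumOver φ f ≡ sumOver φ g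
  sumOver-resp-≗ φ f≗g = cong sum (map-cong (cong φ ∘ f≗g) verts)

  _[_≔_] : (V → Val) → V → Val → V → Val
  (f [ v ≔ a ]) w with w ≟ v
  ... | yes _ = a
  ... | no _ = f w

  update-≡ : ∀ f v a → (f [ v ≔ a ]) v ≡ a
  update-≡ f v a with v ≟ v
  ... | yes _ = refl
  ... | no v≢v = ⊥-elim (v≢v refl)

  update-≢ : ∀ f {v w} a → w ≢ v → (f [ v ≔ a ]) w ≡ f w
  update-≢ f {v} {w} a w≢v with w ≟ v
  ... | yes w≡v = ⊥-elim (w≢v w≡v)
  ... | no _ = refl

  sum-map-update-∉ : ∀ (φ : Val → ℕ) f {v} a {xs} → All (v ≢_) xs →
    sum (map (φ ∘ (f [ v ≔ a ])) xs) ≡ sum (map (φ ∘ f) xs)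
  sum-map-update-∉ φ f a [] = refl
  sum-map-update-∉ φ f a (v≢x ∷ v∉xs) =
    cong₂ _+_ (cong φ (update-≢ f a (v≢x ∘ sym))) (sum-map-update-∉ φ f a v∉xs)

  sum-map-update : ∀ (φ : Val → ℕ) f {v} a {xs} → Unique xs → v ∈ xs →
    φ (f v) + sum (map (φ ∘ (f [ v ≔ a ])) xs) ≡ φ a + sum (map (φ ∘ f) xs)
  sum-map-update φ f {v} a {_ ∷ xs} (v∉xs ∷ _) (here refl) = begin
    φ (f v) + (φ ((f [ v ≔ a ]) v) + sum (map (φ ∘ (f [ v ≔ a ])) xs))
      ≡⟨ cong₂ (λ b s → φ (f v) + (φ b + s)) (update-≡ f v a) (sum-map-update-∉ φ f a v∉xs) ⟩
    φ (f v) + (φ a + sum (map (φ ∘ f) xs))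
      ≡⟨ x∙yz≈y∙xz (φ (f v)) (φ a) _ ⟩
    φ a + (φ (f v) + sum (map (φ ∘ f) xs)) ∎
  sum-map-update φ f {v} a {x ∷ xs} (x∉xs ∷ xs-unique) (there v∈xs) = begin
    φ (f v) + (φ ((f [ v ≔ a ]) x) + sum (map (φ ∘ (f [ v ≔ a ])) xs))
      ≡⟨ cong (λ b → φ (f v) + (φ b + _)) (update-≢ f a (All.lookup x∉xs v∈xs)) ⟩
    φ (f v) + (φ (f x) + sum (map (φ ∘ (f [ v ≔ a ])) xs))
      ≡⟨ x∙yz≈y∙xz (φ (f v)) (φ (f x)) _ ⟩
    φ (f x) + (φ (f v) + sum (map (φ ∘ (f [ v ≔ a ])) xs))
      ≡⟨ cong (φ (f x) +_) (sum-map-update φ f a xs-unique v∈xs) ⟩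
    φ (f x) + (φ a + sum (map (φ ∘ f) xs))
      ≡⟨ x∙yz≈y∙xz (φ (f x)) (φ a) _ ⟩
    φ a + (φ (f x) + sum (map (φ ∘ f) xs)) ∎

  sumOver-update : ∀ φ f v a → φ (f v) + sumOver φ (f [ v ≔ a ]) ≡ φ a + sumOver φ f
  sumOver-update φ f v a = sum-map-update φ f a verts-unique (∈-verts v)

  transfer : (V → Val) → V → V → V → Val
  transfer f u z = (f [ u ≔ one ]) [ z ≔ one ]

  transfer-sumOver : ∀ φ {f u z} → u ≢ z →
    φ (f u) + (φ (f z) + sumOver φ (transfer f u z)) ≡ φ one + (φ one + sumOver φ f)
  transfer-sumOver φ {f} {u} {z} u≢z = begin
    φ (f u) + (φ (f z) + sumOver φ (transfer f u z))
      ≡⟨ cong (λ b → φ (f u) + (φ b + sumOver φ (transfer f u z))) (sym (update-≢ f one (u≢z ∘ sym))) ⟩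
    φ (f u) + (φ ((f [ u ≔ one ]) z) + sumOver φ (transfer f u z))
      ≡⟨ cong (φ (f u) +_) (sumOver-update φ (f [ u ≔ one ]) z one) ⟩
    φ (f u) + (φ one + sumOver φ (f [ u ≔ one ]))
      ≡⟨ x∙yz≈y∙xz (φ (f u)) (φ one) _ ⟩
    φ one + (φ (f u) + sumOver φ (f [ u ≔ one ]))
      ≡⟨ cong (φ one +_) (sumOver-update φ f u one) ⟩
    φ one + (φ one + sumOver φ f) ∎

  transfer-weight : ∀ {f u z} → val (f u) ≡ 2 → val (f z) ≡ 0 → weight (transfer f u z) ≡ weight f
  transfer-weight {f} {u} {z} fu≡2 fz≡0 = suc-injective (suc-injective (trans
    (cong₂ (λ a b → a + (b + weight (transfer f u z))) (sym fu≡2) (sym fz≡0))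
    (transfer-sumOver val {f} {u} {z} (values-≢ fu≡2 fz≡0 λ ()))))

  transfer-zeroCount : ∀ {f u z} → val (f u) ≡ 2 → val (f z) ≡ 0 →
    zeroCount (transfer f u z) < zeroCount f
  transfer-zeroCount {f} {u} {z} fu≡2 fz≡0 = ≤-reflexive (trans
    (cong₂ (λ a b → (1 ∸ a) + ((1 ∸ b) + zeroCount (transfer f u z))) (sym fu≡2) (sym fz≡0))
    (transfer-sumOver isZero {f} {u} {z} (values-≢ fu≡2 fz≡0 λ ())))

  transfer-italian : ∀ {f u z} → IsItalian f → val (f u) ≡ 2 → val (f z) ≡ 0 →
    (∀ {t} → Arc u t → t ≢ z → val (f t) ≢ 0) → IsItalian (transfer f u z)
  transfer-italian {f} {u} {z} fI fu≡2 fz≡0 outs v gv≡0 = dominated (fI v fv≡0)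
    where
      g = transfer f u z

      unchanged : ∀ {x k} → x ≢ u → x ≢ z → val (f x) ≡ k → val (g x) ≡ k
      unchanged x≢u x≢z = trans (cong val (trans (update-≢ _ one x≢z) (update-≢ f one x≢u)))

      v≢u : v ≢ u
      v≢u refl = 1+n≢0 (trans (sym (cong val
        (trans (update-≢ _ one (values-≢ fu≡2 fz≡0 λ ())) (update-≡ f u one)))) gv≡0)

      v≢z : v ≢ z
      v≢z refl = 1+n≢0 (trans (sym (cong val (update-≡ _ z one))) gv≡0)

      fv≡0 : val (f v) ≡ 0
      fv≡0 = trans (sym (unchanged v≢u v≢z refl)) gv≡0

      dominated : Dominated f v → Dominated g v
      dominated (inj₁ (w , w→v , fw≡2)) =
        inj₁ (w , w→v , unchanged (λ { refl → outs w→v v≢z fv≡0 }) (values-≢ fw≡2 fz≡0 λ ()) fw≡2)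
      dominated (inj₂ (x₁ , x₂ , x₁≢x₂ , x₁→v , x₂→v , fx₁≡1 , fx₂≡1)) =
        inj₂ (x₁ , x₂ , x₁≢x₂ , x₁→v , x₂→v ,
              unchanged (values-≢ fx₁≡1 fu≡2 λ ()) (values-≢ fx₁≡1 fz≡0 λ ()) fx₁≡1 ,
              unchanged (values-≢ fx₂≡1 fu≡2 λ ()) (values-≢ fx₂≡1 fz≡0 λ ()) fx₂≡1)

  transfer-improves : ∀ {f u z} → IsItalian f → val (f u) ≡ 2 → val (f z) ≡ 0 →
    (∀ {t} → Arc u t → t ≢ z → val (f t) ≢ 0) → Improvable f
  transfer-improves fI fu≡2 fz≡0 outs =
    transfer _ _ _ , transfer-italian fI fu≡2 fz≡0 outs , transfer-weight fu≡2 fz≡0 , transfer-zeroCount fu≡2 fz≡0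

  ∀-vertex? : {P : V → Set} → (∀ v → Dec (P v)) → Dec (∀ v → P v)
  ∀-vertex? P? = map′ (λ Ps v → All.lookup Ps (∈-verts v)) (λ Ps → All.tabulate (λ {v} _ → Ps v))
                      (All.all? P? verts)

  ∃-vertex? : {P : V → Set} → (∀ v → Dec (P v)) → Dec (∃[ v ] P v)
  ∃-vertex? P? = map′ Any.satisfied (λ (v , Pv) → lose (∈-verts v) Pv) (Any.any? P? verts)

  isItalian? : Decidable Arc → ∀ f → Dec (IsItalian f)
  isItalian? arc? f = ∀-vertex? λ v → (val (f v) ≟ℕ 0) →-dec
    (∃-vertex? (λ w → arc? w v ×-dec val (f w) ≟ℕ 2) ⊎-dec
     ∃-vertex? (λ x₁ → ∃-vertex? λ x₂ →
       ¬? (x₁ ≟ x₂) ×-dec arc? x₁ v ×-dec arc? x₂ v ×-dec val (f x₁) ≟ℕ 1 ×-dec val (f x₂) ≟ℕ 1))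

  -- Every function is pointwise equal to a decoded code, so minimising the weight and then
  -- the number of zeros over the finitely many codes suffices.
  unimprovable-γI-function : ∀ {K} (decode : Fin K → V → Val) (encode : (V → Val) → Fin K) →
    (∀ g → decode (encode g) ≗ g) → Decidable Arc →
    ∀ {f₀} → IsItalian f₀ → ∃[ f ] (IsGammaI f × ¬ Improvable f)
  unimprovable-γI-function {K} decode encode decode-encode arc? f₀I
    with minimal-satisfying (isItalian? arc? ∘ decode) (weight ∘ decode)
                            (isItalian-resp-≗ (decode-encode _) f₀I) (allFin K)
  ... | c₁ , c₁I , c₁-minimal
    with minimal-satisfying (λ c → isItalian? arc? (decode c) ×-dec weight (decode c) ≟ℕ weight (decode c₁))
                            (zeroCount ∘ decode) (c₁I , refl) (allFin K)
  ... | c₂ , (c₂I , c₂≡c₁) , c₂-minimal = decode c₂ , (c₂I , γ-minimal) , unimprovable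
    where
      γ-minimal : ∀ g → IsItalian g → weight (decode c₂) ≤ weight g
      γ-minimal g gI = ≤-trans (≤-reflexive c₂≡c₁) (≤-trans
        (c₁-minimal (∈-allFin (encode g)) (isItalian-resp-≗ (decode-encode g) gI))
        (≤-reflexive (sumOver-resp-≗ val (decode-encode g))))

      unimprovable : ¬ Improvable (decode c₂)
      unimprovable (g , gI , g≡c₂ , g<c₂) = <⇒≱ g<c₂ (≤-trans
        (c₂-minimal (∈-allFin (encode g))
          (isItalian-resp-≗ (decode-encode g) gI ,
           trans (sumOver-resp-≗ val (decode-encode g)) (trans g≡c₂ c₂≡c₁)))
        (≤-reflexive (sumOver-resp-≗ isZero (decode-encode g))))

  module CommutingShifts (σ τ : V → V) (σ-injective : ∀ {x y} → σ x ≡ σ y → x ≡ y)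
                         (τ-injective : ∀ {x y} → τ x ≡ τ y → x ≡ y) (σ∘τ≗τ∘σ : ∀ x → σ (τ x) ≡ τ (σ x))
                         (arc-inv : ∀ {x y} → Arc x y → y ≡ σ x ⊎ y ≡ τ x) where

    inNeighbour-σ : ∀ {x y} → Arc y (σ x) → y ≢ x → σ x ≡ τ y
    inNeighbour-σ y→σx y≢x with arc-inv y→σx
    ... | inj₁ σx≡σy = ⊥-elim (y≢x (sym (σ-injective σx≡σy)))
    ... | inj₂ σx≡τy = σx≡τy

    inNeighbours-σ-coincide : ∀ {x y y′} → Arc y (σ x) → Arc y′ (σ x) → y ≢ x → y′ ≢ x → y ≡ y′
    inNeighbours-σ-coincide y→σx y′→σx y≢x y′≢x =
      τ-injective (trans (sym (inNeighbour-σ y→σx y≢x)) (inNeighbour-σ y′→σx y′≢x))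

    τ-predecessor-two : ∀ {f x} → IsItalian f → val (f x) ≡ 0 → val (f (σ x)) ≡ 0 →
      ∃[ p ] (σ x ≡ τ p × val (f p) ≡ 2)
    τ-predecessor-two fI fx≡0 fσx≡0 with other-inNeighbour-two fI fσx≡0 fx≡0 inNeighbours-σ-coincide
    ... | p , p→σx , fp≡2 = p , inNeighbour-σ p→σx (values-≢ fp≡2 fx≡0 λ ()) , fp≡2

    three-zeros-improvable : ∀ {f x} → IsItalian f →
      val (f x) ≡ 0 → val (f (σ x)) ≡ 0 → val (f (σ (σ x))) ≡ 0 → Improvable f
    three-zeros-improvable {f} {x} fI fx≡0 fσx≡0 fσσx≡0
      with τ-predecessor-two fI fx≡0 fσx≡0 | τ-predecessor-two fI fσx≡0 fσσx≡0
    ... | p , σx≡τp , fp≡2 | q , σσx≡τq , fq≡2 = transfer-improves fI fp≡2 fσx≡0 outs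
      where
        σp≡q : σ p ≡ q
        σp≡q = τ-injective (begin
          τ (σ p)  ≡⟨ sym (σ∘τ≗τ∘σ p) ⟩
          σ (τ p)  ≡⟨ cong σ (sym σx≡τp) ⟩
          σ (σ x)  ≡⟨ σσx≡τq ⟩
          τ q      ∎)

        outs : ∀ {t} → Arc p t → t ≢ σ x → val (f t) ≢ 0
        outs p→t t≢σx with arc-inv p→t
        ... | inj₁ t≡σp = λ ft≡0 → values-≢ {f = f} fq≡2 ft≡0 (λ ()) (sym (trans t≡σp σp≡q))
        ... | inj₂ t≡τp = ⊥-elim (t≢σx (trans t≡τp (sym σx≡τp)))

sucMod-retraction : ∀ {k} .{{_ : NonZero k}} (i : Fin k) → (toℕ (sucMod i) + pred k) % k ≡ toℕ i
sucMod-retraction {k} i = begin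
  (toℕ (sucMod i) + pred k) % k      ≡⟨ cong (λ b → (b + pred k) % k) (toℕ-fromℕ< _) ⟩
  (suc a % k + pred k) % k           ≡⟨ %-distribˡ-+ (suc a % k) (pred k) k ⟩
  (suc a % k % k + pred k % k) % k   ≡⟨ cong (λ b → (b + pred k % k) % k) (m%n%n≡m%n (suc a) k) ⟩
  (suc a % k + pred k % k) % k       ≡⟨ %-distribˡ-+ (suc a) (pred k) k ⟨
  (suc a + pred k) % k               ≡⟨ cong (_% k) (+-suc a (pred k)) ⟨
  (a + suc (pred k)) % k             ≡⟨ cong (λ b → (a + b) % k) (suc-pred k) ⟩
  (a + k) % k                        ≡⟨ [m+n]%n≡m%n a k ⟩
  a % k                              ≡⟨ m<n⇒m%n≡m (toℕ<n i) ⟩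
  a                                  ∎
  where
    open ≡-Reasoning
    a = toℕ i

sucMod-injective : ∀ {k} .{{_ : NonZero k}} {i j : Fin k} → sucMod i ≡ sucMod j → i ≡ j
sucMod-injective {k} {i} {j} eq = toℕ-injective (trans (sym (sucMod-retraction i))
  (trans (cong (λ s → (toℕ s + pred k) % k) eq) (sucMod-retraction j)))

module Torus (m n : ℕ) .{{_ : NonZero m}} .{{_ : NonZero n}} where

  Vertex : Set
  Vertex = Fin m × Fin n

  _≟_ : DecidableEquality Vertex
  _≟_ = ≡-dec _≟Fin_ _≟Fin_

  stepʰ stepᵛ : Vertex → Vertex
  stepʰ (i , j) = sucMod i , j
  stepᵛ (i , j) = i , sucMod j

  stepʰ-injective : ∀ {x y} → stepʰ x ≡ stepʰ y → x ≡ y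
  stepʰ-injective eq = cong₂ _,_ (sucMod-injective (cong proj₁ eq)) (cong proj₂ eq)

  stepᵛ-injective : ∀ {x y} → stepᵛ x ≡ stepᵛ y → x ≡ y
  stepᵛ-injective eq = cong₂ _,_ (cong proj₁ eq) (sucMod-injective (cong proj₂ eq))

  arc-inv : ∀ {x y} → TorusArc m n x y → y ≡ stepʰ x ⊎ y ≡ stepᵛ x
  arc-inv (horiz i j) = inj₁ refl
  arc-inv (vert i j) = inj₂ refl

  arc? : Decidable (TorusArc m n)
  arc? (i , j) y = map′ (λ { (inj₁ refl) → horiz i j ; (inj₂ refl) → vert i j }) arc-inv
                        ((y ≟ stepʰ (i , j)) ⊎-dec (y ≟ stepᵛ (i , j)))

  decode : Fin ((3 ^ n) ^ m) → Vertex → Val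
  decode c (i , j) = finToFun (finToFun c i) j

  encode : (Vertex → Val) → Fin ((3 ^ n) ^ m)
  encode g = funToFin (λ i → funToFin (λ j → g (i , j)))

  decode-encode : ∀ g → decode (encode g) ≗ g
  decode-encode g (i , j) =
    trans (cong (λ r → finToFun r j) (finToFun-funToFin _ i)) (finToFun-funToFin _ j)

  open ItalianProperties (TorusArc m n) (torusVerts m n) _≟_
         (cartesianProduct⁺ (allFin⁺ m) (allFin⁺ n)) (λ (i , j) → ∈-cartesianProduct⁺ (∈-allFin i) (∈-allFin j))

  module Horizontal = CommutingShifts stepʰ stepᵛ stepʰ-injective stepᵛ-injective (λ _ → refl) arc-inv
  module Vertical   = CommutingShifts stepᵛ stepʰ stepᵛ-injective stepʰ-injective (λ _ → refl) (swap ∘ arc-inv)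

  unimprovable-γI : ∃[ f ] (Italian.IsGammaI (TorusArc m n) (torusVerts m n) f × ¬ Improvable f)
  unimprovable-γI = unimprovable-γI-function decode encode decode-encode arc? {λ _ → one} (λ _ ())

-- The argument does not use m, n ≥ 2.
mainTheorem1 : (m n : ℕ) → 2 ≤ m → 2 ≤ n → .{{_ : NonZero m}} → .{{_ : NonZero n}} →
    ∃[ f ] (Italian.IsGammaI (TorusArc m n) (torusVerts m n) f
      × (∀ (i : Fin m) (k : Fin n) →
           ¬ (f (i , k) ≡ zero × f (sucMod i , k) ≡ zero × f (sucMod (sucMod i) , k) ≡ zero))
      × (∀ (i : Fin m) (k : Fin n) →
           ¬ (f (i , k) ≡ zero × f (i , sucMod k) ≡ zero × f (i , sucMod (sucMod k)) ≡ zero)))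
mainTheorem1 m n _ _ =
  let open Torus m n
      f , f-γI , f-unimprovable = unimprovable-γI
  in f , f-γI ,
     (λ i k (f₀ , f₁ , f₂) → f-unimprovable
       (Horizontal.three-zeros-improvable (proj₁ f-γI) (cong val f₀) (cong val f₁) (cong val f₂))) ,
     (λ i k (f₀ , f₁ , f₂) → f-unimprovable
       (Vertical.three-zeros-improvable (proj₁ f-γI) (cong val f₀) (cong val f₁) (cong val f₂)))
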